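{- Let $\mathcal{B}=\{u\in\Sigma^+ : u_0=0\}$. The map $\Delta_T:\mathcal{B}\to(\Sigma\cup\mathrm{S}_\Sigma)^+$ is injective and satisfies $\Delta_T(0)=?$ and $\Delta_T(u\times v)=\Delta_T(u)\circ\Delta_T(v)$ for all $u,v\in\mathcal{B}$; i.e. it is an injective monoid homomorphism from $(\mathcal{B},\times,0)$ into the monoid of $\Sigma$-patterns under Toeplitz composition with identity $?$.
   Context: $\Sigma$ is a fixed finite cyclic group; $\mathrm{S}_\Sigma$ the group of bijections of $\Sigma$ (gaps), $?$ its identity, $\rho_d$ the bijection $x\mapsto x+d$. Keane product: $u\times\varepsilon=\varepsilon$, $u\times(av)=(u+a)(u\times v)$ where $u+a$ adds $a$ to each letter. First difference: $\Delta(x_0\dots x_{k-1})=(x_1-x_0)\dots(x_{k-1}-x_{k-2})$ ($=\varepsilon$ if $k=1$). $\Delta_T(u)=\Delta(u)\,\rho_{ -u_{|u|-1}}$. For finite words $x,y$ over $\Sigma\cup\mathrm{S}_\Sigma$ with number of gaps of $x$ equal to $|y|$: $x\langle\varepsilon\rangle=x$, $(a\,x)\langle y\rangle=a\,x\langle y\rangle$, $(f\,x)\langle b\,y\rangle=f(b)\,x\langle y\rangle$, $(f\,x)\langle g\,y\rangle=(f\circ g)\,x\langle y\rangle$. With $\xi(n,m)=m/\gcd(n,m)$ and $|P|_?$ the number of gaps, the Toeplitz composition is $P\circ Q=P$ if $|P|_?=0$, else $P\circ Q=P^{d_1}\langle Q^{d_2}\rangle$ with $d_1=\xi(|P|_?,|Q|)$,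 $d_2=\xi(|Q|,|P|_?)$. -}

module Defs where

open import Data.Nat as ℕ using (ℕ; suc; zero; _%_; _/_; NonZero)
open import Data.Nat.DivMod using (m%n<n; %-distribˡ-+; m%n%n≡m%n; [m+n]%n≡m%n; m<n⇒m%n≡m)
open import Data.Nat.Properties using (+-assoc; m∸n+n≡m; <⇒≤; +-comm)
open import Data.Nat.GCD using (gcd)
open import Data.Fin as Fin using (Fin; toℕ; fromℕ<)
open import Data.Fin.Properties using (toℕ-fromℕ<; toℕ-injective; toℕ<n)
open import Data.Fin.Permutation using (Permutation′; permutation; _⟨$⟩ʳ_; _∘ₚ_)
open import Data.List as List using (List; []; _∷_; _++_; concat; replicate)
open import Data.List.NonEmpty as List⁺ using (List⁺; _∷_; _⁺++_; toList; last)
open import Data.List.Relation.Binary.Pointwise using (Pointwise)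
open import Data.Sum using (_⊎_; inj₁; inj₂)
open import Relation.Binary.PropositionalEquality

-- The alphabet Σ = ℤ/(suc k)ℤ, represented by Fin (suc k) with
-- addition modulo suc k.

module _ {k : ℕ} where

  private
    n = suc k

  _⊕_ : Fin n → Fin n → Fin n
  a ⊕ b = fromℕ< (m%n<n (toℕ a ℕ.+ toℕ b) n)

  ⊖_ : Fin n → Fin n
  ⊖ a = fromℕ< (m%n<n (n ℕ.∸ toℕ a) n)

  _⊝_ : Fin n → Fin n → Fin n
  a ⊝ b = a ⊕ (⊖ b)

  private
    toℕ-⊕ : ∀ a b → toℕ (a ⊕ b) ≡ (toℕ a ℕ.+ toℕ b) % n
    toℕ-⊕ a b = toℕ-fromℕ< _

    toℕ-⊖ : ∀ a → toℕ (⊖ a) ≡ (n ℕ.∸ toℕ a) % n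
    toℕ-⊖ a = toℕ-fromℕ< _

    absorbˡ : ∀ x y → (x % n ℕ.+ y) % n ≡ (x ℕ.+ y) % n
    absorbˡ x y = begin
        (x % n ℕ.+ y) % n            ≡⟨ %-distribˡ-+ (x % n) y n ⟩
        (x % n % n ℕ.+ y % n) % n    ≡⟨ cong (λ z → (z ℕ.+ y % n) % n) (m%n%n≡m%n x n) ⟩
        (x % n ℕ.+ y % n) % n        ≡⟨ sym (%-distribˡ-+ x y n) ⟩
        (x ℕ.+ y) % n                ∎
      where open ≡-Reasoning

    absorbʳ : ∀ x y → (x ℕ.+ y % n) % n ≡ (x ℕ.+ y) % n
    absorbʳ x y = begin
        (x ℕ.+ y % n) % n ≡⟨ cong (_% n) (+-comm x (y % n)) ⟩
        (y % n ℕ.+ x) % n ≡⟨ absorbˡ y x ⟩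
        (y ℕ.+ x) % n     ≡⟨ cong (_% n) (+-comm y x) ⟩
        (x ℕ.+ y) % n     ∎
      where open ≡-Reasoning

    ⊕-⊖ : ∀ x d → (x ⊕ d) ⊕ (⊖ d) ≡ x
    ⊕-⊖ x d = toℕ-injective (begin
        toℕ ((x ⊕ d) ⊕ (⊖ d))                                   ≡⟨ toℕ-⊕ (x ⊕ d) (⊖ d) ⟩
        (toℕ (x ⊕ d) ℕ.+ toℕ (⊖ d)) % n                          ≡⟨ cong₂ (λ p q → (p ℕ.+ q) % n) (toℕ-⊕ x d) (toℕ-⊖ d) ⟩
        ((toℕ x ℕ.+ toℕ d) % n ℕ.+ (n ℕ.∸ toℕ d) % n) % n        ≡⟨ absorbˡ (toℕ x ℕ.+ toℕ d) ((n ℕ.∸ toℕ d) % n) ⟩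
        ((toℕ x ℕ.+ toℕ d) ℕ.+ (n ℕ.∸ toℕ d) % n) % n            ≡⟨ absorbʳ (toℕ x ℕ.+ toℕ d) (n ℕ.∸ toℕ d) ⟩
        ((toℕ x ℕ.+ toℕ d) ℕ.+ (n ℕ.∸ toℕ d)) % n                ≡⟨ cong (_% n) (+-assoc (toℕ x) (toℕ d) _) ⟩
        (toℕ x ℕ.+ (toℕ d ℕ.+ (n ℕ.∸ toℕ d))) % n                ≡⟨ cong (λ z → (toℕ x ℕ.+ z) % n) (trans (+-comm (toℕ d) _) (m∸n+n≡m (<⇒≤ (toℕ<n d)))) ⟩
        (toℕ x ℕ.+ n) % n                                          ≡⟨ [m+n]%n≡m%n (toℕ x) n ⟩
        toℕ x % n                                                  ≡⟨ m<n⇒m%n≡m (toℕ<n x) ⟩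
        toℕ x ∎)
      where open ≡-Reasoning

    ⊖-⊕ : ∀ x d → (x ⊕ (⊖ d)) ⊕ d ≡ x
    ⊖-⊕ x d = toℕ-injective (begin
        toℕ ((x ⊕ (⊖ d)) ⊕ d)                                   ≡⟨ toℕ-⊕ (x ⊕ (⊖ d)) d ⟩
        (toℕ (x ⊕ (⊖ d)) ℕ.+ toℕ d) % n                          ≡⟨ cong (λ p → (p ℕ.+ toℕ d) % n) (trans (toℕ-⊕ x (⊖ d)) (cong (λ q → (toℕ x ℕ.+ q) % n) (toℕ-⊖ d))) ⟩
        ((toℕ x ℕ.+ (n ℕ.∸ toℕ d) % n) % n ℕ.+ toℕ d) % n        ≡⟨ absorbˡ (toℕ x ℕ.+ (n ℕ.∸ toℕ d) % n) (toℕ d) ⟩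
        ((toℕ x ℕ.+ (n ℕ.∸ toℕ d) % n) ℕ.+ toℕ d) % n            ≡⟨ cong (_% n) (+-assoc (toℕ x) _ (toℕ d)) ⟩
        (toℕ x ℕ.+ ((n ℕ.∸ toℕ d) % n ℕ.+ toℕ d)) % n            ≡⟨ sym (absorbʳ (toℕ x) ((n ℕ.∸ toℕ d) % n ℕ.+ toℕ d)) ⟩
        (toℕ x ℕ.+ ((n ℕ.∸ toℕ d) % n ℕ.+ toℕ d) % n) % n        ≡⟨ cong (λ z → (toℕ x ℕ.+ z) % n) (absorbˡ (n ℕ.∸ toℕ d) (toℕ d)) ⟩
        (toℕ x ℕ.+ ((n ℕ.∸ toℕ d) ℕ.+ toℕ d) % n) % n            ≡⟨ absorbʳ (toℕ x) ((n ℕ.∸ toℕ d) ℕ.+ toℕ d) ⟩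
        (toℕ x ℕ.+ ((n ℕ.∸ toℕ d) ℕ.+ toℕ d)) % n                ≡⟨ cong (λ z → (toℕ x ℕ.+ z) % n) (m∸n+n≡m (<⇒≤ (toℕ<n d))) ⟩
        (toℕ x ℕ.+ n) % n                                          ≡⟨ [m+n]%n≡m%n (toℕ x) n ⟩
        toℕ x % n                                                  ≡⟨ m<n⇒m%n≡m (toℕ<n x) ⟩
        toℕ x ∎)
      where open ≡-Reasoning

  ρ : Fin n → Permutation′ n
  ρ d = permutation (_⊕ d) (_⊕ (⊖ d)) (λ y → ⊖-⊕ y d) (λ x → ⊕-⊖ x d)

  -- Letters of patterns: Σ ∪ S_Σ (elements of S_Σ are the gaps)

  Letter : Set
  Letter = Fin n ⊎ Permutation′ n

  Word : Set
  Word = List Letter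

  data _≈L_ : Letter → Letter → Set where
    sym≈ : ∀ {a b} → a ≡ b → inj₁ a ≈L inj₁ b
    gap≈ : ∀ {f g : Permutation′ n} → (∀ x → f ⟨$⟩ʳ x ≡ g ⟨$⟩ʳ x) → inj₂ f ≈L inj₂ g

  _≈W_ : Word → Word → Set
  _≈W_ = Pointwise _≈L_

  _∘S_ : Permutation′ n → Permutation′ n → Permutation′ n
  f ∘S g = g ∘ₚ f

  ∘S-spec : ∀ f g x → (f ∘S g) ⟨$⟩ʳ x ≡ f ⟨$⟩ʳ (g ⟨$⟩ʳ x)
  ∘S-spec f g x = refl

  gaps : Word → ℕ
  gaps []           = 0
  gaps (inj₁ _ ∷ x) = gaps x
  gaps (inj₂ _ ∷ x) = suc (gaps x)

  -- x⟨y⟩ (total extension: when y is exhausted the remaining gaps are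
  -- kept, extra letters of y are dropped; in the Toeplitz composition
  -- the lengths always match, so this is the paper's operation there)
  _⟨_⟩ : Word → Word → Word
  []           ⟨ y ⟩          = []
  (inj₁ a ∷ x) ⟨ y ⟩          = inj₁ a ∷ (x ⟨ y ⟩)
  (inj₂ f ∷ x) ⟨ [] ⟩         = inj₂ f ∷ (x ⟨ [] ⟩)
  (inj₂ f ∷ x) ⟨ inj₁ b ∷ y ⟩ = inj₁ (f ⟨$⟩ʳ b) ∷ (x ⟨ y ⟩)
  (inj₂ f ∷ x) ⟨ inj₂ g ∷ y ⟩ = inj₂ (f ∘S g) ∷ (x ⟨ y ⟩)

  _^W_ : Word → ℕ → Word
  P ^W d = concat (replicate d P)

  _∘T_ : Word → Word → Word
  P ∘T Q with gaps P
  ... | zero    = P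
  ... | suc g   = (P ^W ξ (suc g) (List.length Q)) ⟨ Q ^W ξ (List.length Q) (suc g) ⟩
    where
      -- ξ(a,b) = b / gcd(a,b)   (gcd(a,b) ≠ 0 here since the first
      -- argument or the second is positive; value 0 otherwise, unused)
      ξ : ℕ → ℕ → ℕ
      ξ a b with gcd a b
      ... | zero  = 0
      ... | suc c = b / suc c

  _+L_ : List⁺ (Fin n) → Fin n → List⁺ (Fin n)
  u +L a = List⁺.map (_⊕ a) u

  private
    keaneL : List⁺ (Fin n) → List (Fin n) → List (Fin n)
    keaneL u []      = []
    keaneL u (a ∷ v) = toList (u +L a) ++ keaneL u v

  _⊗_ : List⁺ (Fin n) → List⁺ (Fin n) → List⁺ (Fin n)
  u ⊗ (a ∷ v) = (u +L a) ⁺++ keaneL u v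

  Δ : List (Fin n) → List (Fin n)
  Δ []            = []
  Δ (x ∷ [])      = []
  Δ (x ∷ y ∷ r)   = (y ⊝ x) ∷ Δ (y ∷ r)

  ΔT : List⁺ (Fin n) → Word
  ΔT u = List.map inj₁ (Δ (toList u)) ++ (inj₂ (ρ (⊖ last u)) ∷ [])

-- Since Δ_T u has exactly
--     one gap, P ∘ Q = P^{|Q|}⟨Q⟩, and filling the gap of one copy of P
--     with a letter of Q simply applies ρ_{-last u} to that letter.
--   * The Keane product u × (b v) is the block u + b followed by u × v;
--     comparing both sides block by block, induction on v gives the
--     homomorphism property (this needs u₀ = 0 at the junctions).
-- Injectivity holds because a word is recovered from its first letter and
-- its differences; Δ_T 0 = ? since ρ_0 is the identity.
module Submission where

open import Data.Nat using (ℕ; suc)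
open import Data.Fin using (Fin; zero)
open import Data.List using ([]; _∷_)
open import Data.List.NonEmpty using (List⁺; _∷_; head)
open import Data.Sum using (inj₂)
open import Relation.Binary.PropositionalEquality using (_≡_)

open import Defs
open import Level using (0ℓ)
open import Algebra.Bundles using (AbelianGroup)
open import Algebra.Structures using (IsAbelianGroup)
import Algebra.Properties.AbelianGroup as AbelianGroupProperties
open import Data.Nat as ℕ using (_%_)
open import Data.Nat.DivMod using (%-distribˡ-+; m%n%n≡m%n; n%n≡0; m<n⇒m%n≡m; n/1≡n)
open import Data.Nat.Properties using (+-assoc; +-comm; +-identityʳ; m∸n+n≡m; <⇒≤)
open import Data.Nat.GCD using (gcd-zeroˡ; gcd-zeroʳ)
open import Data.Fin using (toℕ)
open import Data.Fin.Properties using (toℕ-fromℕ<; toℕ-injective; toℕ<n)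
open import Data.Fin.Permutation using (Permutation′; _⟨$⟩ʳ_; id)
open import Data.List as List using (List; _++_; length)
open import Data.List.Properties using (++-identityʳ)
open import Data.List.Relation.Binary.Pointwise using ([]; _∷_; ++⁺)
import Data.List.Relation.Binary.Pointwise.Properties as Pointwise
open import Data.List.NonEmpty as List⁺ using (last; toList)
open import Data.Product using (_×_; _,_)
open import Data.Sum using (inj₁)
open import Relation.Binary.PropositionalEquality
  using (refl; sym; trans; cong; cong₂; isEquivalence; subst₂; module ≡-Reasoning)

lastOf : ∀ {A : Set} → A → List A → A
lastOf x []       = x
lastOf x (y ∷ ys) = lastOf y ys

-- It agrees with the library's `last`, which is computed via a snoc view.
last≡lastOf : ∀ {A : Set} (x : A) xs → last (x ∷ xs) ≡ lastOf x xs
last≡lastOf x [] = refl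
last≡lastOf x (y ∷ ys) with List.initLast ys | last≡lastOf y ys
... | []            | ih = ih
... | _ List.∷ʳ′ _  | ih = ih

module _ {k : ℕ} where
  private
    n = suc k
    Σ = Fin n

  toℕ-⊕ : ∀ (a b : Σ) → toℕ (a ⊕ b) ≡ (toℕ a ℕ.+ toℕ b) % n
  toℕ-⊕ a b = toℕ-fromℕ< _

  toℕ-⊖ : ∀ (a : Σ) → toℕ (⊖ a) ≡ (n ℕ.∸ toℕ a) % n
  toℕ-⊖ a = toℕ-fromℕ< _

  %-absorbˡ : ∀ x y → (x % n ℕ.+ y) % n ≡ (x ℕ.+ y) % n
  %-absorbˡ x y = begin
    (x % n ℕ.+ y) % n          ≡⟨ %-distribˡ-+ (x % n) y n ⟩
    (x % n % n ℕ.+ y % n) % n  ≡⟨ cong (λ z → (z ℕ.+ y % n) % n) (m%n%n≡m%n x n) ⟩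
    (x % n ℕ.+ y % n) % n      ≡⟨ %-distribˡ-+ x y n ⟨
    (x ℕ.+ y) % n              ∎
    where open ≡-Reasoning

  %-absorbʳ : ∀ x y → (x ℕ.+ y % n) % n ≡ (x ℕ.+ y) % n
  %-absorbʳ x y = begin
    (x ℕ.+ y % n) % n  ≡⟨ cong (_% n) (+-comm x (y % n)) ⟩
    (y % n ℕ.+ x) % n  ≡⟨ %-absorbˡ y x ⟩
    (y ℕ.+ x) % n      ≡⟨ cong (_% n) (+-comm y x) ⟩
    (x ℕ.+ y) % n      ∎
    where open ≡-Reasoning

  ⊕-comm : ∀ (a b : Σ) → a ⊕ b ≡ b ⊕ a
  ⊕-comm a b = toℕ-injective (begin
    toℕ (a ⊕ b)                ≡⟨ toℕ-⊕ a b ⟩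
    (toℕ a ℕ.+ toℕ b) % n      ≡⟨ cong (_% n) (+-comm (toℕ a) (toℕ b)) ⟩
    (toℕ b ℕ.+ toℕ a) % n      ≡⟨ toℕ-⊕ b a ⟨
    toℕ (b ⊕ a)                ∎)
    where open ≡-Reasoning

  ⊕-assoc : ∀ (a b c : Σ) → (a ⊕ b) ⊕ c ≡ a ⊕ (b ⊕ c)
  ⊕-assoc a b c = toℕ-injective (begin
    toℕ ((a ⊕ b) ⊕ c)                        ≡⟨ toℕ-⊕ (a ⊕ b) c ⟩
    (toℕ (a ⊕ b) ℕ.+ toℕ c) % n              ≡⟨ cong (λ z → (z ℕ.+ toℕ c) % n) (toℕ-⊕ a b) ⟩
    ((toℕ a ℕ.+ toℕ b) % n ℕ.+ toℕ c) % n    ≡⟨ %-absorbˡ (toℕ a ℕ.+ toℕ b) (toℕ c) ⟩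
    (toℕ a ℕ.+ toℕ b ℕ.+ toℕ c) % n          ≡⟨ cong (_% n) (+-assoc (toℕ a) (toℕ b) (toℕ c)) ⟩
    (toℕ a ℕ.+ (toℕ b ℕ.+ toℕ c)) % n        ≡⟨ %-absorbʳ (toℕ a) (toℕ b ℕ.+ toℕ c) ⟨
    (toℕ a ℕ.+ (toℕ b ℕ.+ toℕ c) % n) % n    ≡⟨ cong (λ z → (toℕ a ℕ.+ z) % n) (toℕ-⊕ b c) ⟨
    (toℕ a ℕ.+ toℕ (b ⊕ c)) % n              ≡⟨ toℕ-⊕ a (b ⊕ c) ⟨
    toℕ (a ⊕ (b ⊕ c))                        ∎)
    where open ≡-Reasoning

  ⊕-identityʳ : ∀ (a : Σ) → a ⊕ zero ≡ a
  ⊕-identityʳ a = toℕ-injective (begin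
    toℕ (a ⊕ zero)     ≡⟨ toℕ-⊕ a zero ⟩
    (toℕ a ℕ.+ 0) % n  ≡⟨ cong (_% n) (+-identityʳ (toℕ a)) ⟩
    toℕ a % n          ≡⟨ m<n⇒m%n≡m (toℕ<n a) ⟩
    toℕ a              ∎)
    where open ≡-Reasoning

  ⊕-inverseʳ : ∀ (a : Σ) → a ⊕ (⊖ a) ≡ zero
  ⊕-inverseʳ a = toℕ-injective (begin
    toℕ (a ⊕ (⊖ a))                      ≡⟨ toℕ-⊕ a (⊖ a) ⟩
    (toℕ a ℕ.+ toℕ (⊖ a)) % n            ≡⟨ cong (λ z → (toℕ a ℕ.+ z) % n) (toℕ-⊖ a) ⟩
    (toℕ a ℕ.+ (n ℕ.∸ toℕ a) % n) % n    ≡⟨ %-absorbʳ (toℕ a) (n ℕ.∸ toℕ a) ⟩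
    (toℕ a ℕ.+ (n ℕ.∸ toℕ a)) % n        ≡⟨ cong (_% n) (+-comm (toℕ a) (n ℕ.∸ toℕ a)) ⟩
    ((n ℕ.∸ toℕ a) ℕ.+ toℕ a) % n        ≡⟨ cong (_% n) (m∸n+n≡m (<⇒≤ (toℕ<n a))) ⟩
    n % n                                ≡⟨ n%n≡0 n ⟩
    0                                    ∎)
    where open ≡-Reasoning

  ⊕-isAbelianGroup : IsAbelianGroup _≡_ _⊕_ zero ⊖_
  ⊕-isAbelianGroup = record
    { isGroup = record
      { isMonoid = record
        { isSemigroup = record
          { isMagma = record { isEquivalence = isEquivalence ; ∙-cong = cong₂ _⊕_ }
          ; assoc   = ⊕-assoc
          }
        ; identity = (λ a → trans (⊕-comm zero a) (⊕-identityʳ a)) , ⊕-identityʳ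
        }
      ; inverse = (λ a → trans (⊕-comm (⊖ a) a) (⊕-inverseʳ a)) , ⊕-inverseʳ
      ; ⁻¹-cong = cong ⊖_
      }
    ; comm = ⊕-comm
    }

  cyclicGroup : AbelianGroup 0ℓ 0ℓ
  cyclicGroup = record { isAbelianGroup = ⊕-isAbelianGroup }

  open AbelianGroup cyclicGroup using (identityˡ)
  open AbelianGroupProperties cyclicGroup using (ε⁻¹≈ε; ⁻¹-anti-homo-∙; ∙-cancelʳ)

  ⊝-⊕ : ∀ (x c b : Σ) → x ⊝ (c ⊕ b) ≡ (x ⊝ b) ⊝ c
  ⊝-⊕ x c b = trans (cong (x ⊕_) (⁻¹-anti-homo-∙ c b)) (sym (⊕-assoc x (⊖ b) (⊖ c)))

  ρ-zero : ∀ (x : Σ) → ρ (⊖ zero) ⟨$⟩ʳ x ≡ x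
  ρ-zero x = trans (cong (x ⊕_) ε⁻¹≈ε) (⊕-identityʳ x)

  ⊝-translate : ∀ (y x b : Σ) → (y ⊕ b) ⊝ (x ⊕ b) ≡ y ⊝ x
  ⊝-translate y x b = begin
    (y ⊕ b) ⊝ (x ⊕ b)          ≡⟨ ⊝-⊕ (y ⊕ b) x b ⟩
    ((y ⊕ b) ⊕ (⊖ b)) ⊝ x      ≡⟨ cong (_⊝ x) (⊕-assoc y b (⊖ b)) ⟩
    (y ⊕ (b ⊕ (⊖ b))) ⊝ x      ≡⟨ cong (λ z → (y ⊕ z) ⊝ x) (⊕-inverseʳ b) ⟩
    (y ⊕ zero) ⊝ x             ≡⟨ cong (_⊝ x) (⊕-identityʳ y) ⟩
    y ⊝ x                      ∎
    where open ≡-Reasoning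

  ≈L-refl : ∀ (a : Letter {k}) → a ≈L a
  ≈L-refl (inj₁ a) = sym≈ refl
  ≈L-refl (inj₂ f) = gap≈ (λ _ → refl)

  ≈W-refl : ∀ (P : Word {k}) → P ≈W P
  ≈W-refl P = Pointwise.refl (λ {a} → ≈L-refl a)

  transport : ∀ {P P′ Q Q′ : Word {k}} → P ≡ P′ → P′ ≈W Q′ → Q ≡ Q′ → P ≈W Q
  transport p≡ p≈q q≡ = subst₂ _≈W_ (sym p≡) (sym q≡) p≈q

  D : List Σ → Word {k}
  D w = List.map inj₁ (Δ w)

  gap : Σ → Letter {k}
  gap c = inj₂ (ρ (⊖ c))

  ΔT′ : Σ → List Σ → Word {k}
  ΔT′ x xs = D (x ∷ xs) ++ gap (lastOf x xs) ∷ []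

  ΔT-unfold : ∀ (x : Σ) xs → ΔT (x ∷ xs) ≡ ΔT′ x xs
  ΔT-unfold x xs = cong (λ c → D (x ∷ xs) ++ gap c ∷ []) (last≡lastOf x xs)

  -- What Δ_T puts after the differences of a block ending in e, when the
  -- block is followed by the list `rest`.
  junction : Σ → List Σ → Word {k}
  junction e []       = gap e ∷ []
  junction e (y ∷ ys) = inj₁ (y ⊝ e) ∷ ΔT′ y ys

  ΔT′-++ : ∀ (x : Σ) xs rest → ΔT′ x (xs ++ rest) ≡ D (x ∷ xs) ++ junction (lastOf x xs) rest
  ΔT′-++ x []       []       = refl
  ΔT′-++ x []       (y ∷ ys) = refl
  ΔT′-++ x (z ∷ xs) rest     = cong (inj₁ (z ⊝ x) ∷_) (ΔT′-++ z xs rest)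

  Δ-translate : ∀ (b x : Σ) xs → Δ (List.map (_⊕ b) (x ∷ xs)) ≡ Δ (x ∷ xs)
  Δ-translate b x []       = refl
  Δ-translate b x (y ∷ ys) = cong₂ _∷_ (⊝-translate y x b) (Δ-translate b y ys)

  lastOf-translate : ∀ (b x : Σ) xs → lastOf (x ⊕ b) (List.map (_⊕ b) xs) ≡ lastOf x xs ⊕ b
  lastOf-translate b x []       = refl
  lastOf-translate b x (y ∷ ys) = lastOf-translate b y ys

  gaps-ΔT′ : ∀ (x : Σ) xs → gaps (ΔT′ x xs) ≡ 1
  gaps-ΔT′ x []       = refl
  gaps-ΔT′ x (y ∷ ys) = gaps-ΔT′ y ys

  length-ΔT′ : ∀ (x : Σ) xs → length (ΔT′ x xs) ≡ suc (length xs)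
  length-ΔT′ x []       = refl
  length-ΔT′ x (y ∷ ys) = cong suc (length-ΔT′ y ys)

  -- Toeplitz composition with a one-gap pattern: P ∘ Q = P^{|Q|}⟨Q⟩,
  -- since ξ(1, |Q|) = |Q| and ξ(|Q|, 1) = 1.
  ∘T-oneGap : ∀ (P Q : Word {k}) → gaps P ≡ 1 → P ∘T Q ≡ (P ^W length Q) ⟨ Q ⟩
  ∘T-oneGap P Q one rewrite one | gcd-zeroˡ (length Q) | gcd-zeroʳ (length Q) | n/1≡n (length Q) =
    cong ((P ^W length Q) ⟨_⟩) (++-identityʳ Q)

  fillGap : Permutation′ n → Letter {k} → Letter {k}
  fillGap f (inj₁ b) = inj₁ (f ⟨$⟩ʳ b)
  fillGap f (inj₂ g) = inj₂ (f ∘S g)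

  fill : ∀ (xs : List Σ) f (R : Word {k}) y ys →
         ((List.map inj₁ xs ++ inj₂ f ∷ []) ++ R) ⟨ y ∷ ys ⟩ ≡ List.map inj₁ xs ++ fillGap f y ∷ (R ⟨ ys ⟩)
  fill []       f R (inj₁ b) ys = refl
  fill []       f R (inj₂ g) ys = refl
  fill (x ∷ xs) f R y        ys = cong (inj₁ x ∷_) (fill xs f R y ys)

  module Homomorphism (us : List Σ) where
    u : List⁺ Σ
    u = zero ∷ us

    c : Σ
    c = lastOf zero us

    P : Word {k}
    P = ΔT′ zero us

    block : ∀ b rest → ΔT ((zero ⊕ b) ∷ (List.map (_⊕ b) us ++ rest)) ≡ D (toList u) ++ junction (c ⊕ b) rest
    block b rest = begin
      ΔT ((zero ⊕ b) ∷ (List.map (_⊕ b) us ++ rest))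
        ≡⟨ ΔT-unfold (zero ⊕ b) (List.map (_⊕ b) us ++ rest) ⟩
      ΔT′ (zero ⊕ b) (List.map (_⊕ b) us ++ rest)
        ≡⟨ ΔT′-++ (zero ⊕ b) (List.map (_⊕ b) us) rest ⟩
      D (List.map (_⊕ b) (toList u)) ++ junction (lastOf (zero ⊕ b) (List.map (_⊕ b) us)) rest
        ≡⟨ cong₂ (λ d e → List.map inj₁ d ++ junction e rest) (Δ-translate b zero us) (lastOf-translate b zero us) ⟩
      D (toList u) ++ junction (c ⊕ b) rest ∎
      where open ≡-Reasoning

    -- At the junction of the blocks u + b and u + b′ the difference is
    -- (b′ - b) - c; this is where u₀ = 0 is used.
    junction-letter : ∀ b b′ → (zero ⊕ b′) ⊝ (c ⊕ b) ≡ (b′ ⊝ b) ⊝ c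
    junction-letter b b′ = trans (cong (_⊝ (c ⊕ b)) (identityˡ b′)) (⊝-⊕ b′ c b)

    ΔT-⊗ : ∀ b vs → ΔT (u ⊗ (b ∷ vs)) ≈W ((P ^W suc (length vs)) ⟨ ΔT′ b vs ⟩)
    ΔT-⊗ b [] =
      transport (block b [])
                (++⁺ (≈W-refl (D (toList u))) (gap≈ (λ x → ⊝-⊕ x c b) ∷ []))
                (fill (Δ (toList u)) (ρ (⊖ c)) [] (gap b) [])
    ΔT-⊗ b (b′ ∷ vs) =
      transport (block b (toList w))
                (++⁺ (≈W-refl (D (toList u)))
                     (sym≈ (junction-letter b b′) ∷ transport (sym (ΔT-unfold (head w) (List⁺.tail w))) (ΔT-⊗ b′ vs) refl))
                (fill (Δ (toList u)) (ρ (⊖ c)) (P ^W suc (length vs)) (inj₁ (b′ ⊝ b)) (ΔT′ b′ vs))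
      where
        w : List⁺ Σ
        w = u ⊗ (b′ ∷ vs)

  ΔT′-injective : ∀ (x : Σ) xs ys f g →
    (D (x ∷ xs) ++ inj₂ f ∷ []) ≈W (D (x ∷ ys) ++ inj₂ g ∷ []) → xs ≡ ys
  ΔT′-injective x []        []        f g _ = refl
  ΔT′-injective x []        (_ ∷ _)   f g (() ∷ _)
  ΔT′-injective x (_ ∷ _)   []        f g (() ∷ _)
  ΔT′-injective x (x′ ∷ xs) (y′ ∷ ys) f g (sym≈ d ∷ rest)
    with ∙-cancelʳ (⊖ x) x′ y′ d
  ... | refl = cong (x′ ∷_) (ΔT′-injective x′ xs ys f g rest)

mainTheorem4 : ∀ {k : ℕ} →
    (∀ (u v : List⁺ (Fin (suc k))) → head u ≡ zero → head v ≡ zero → ΔT u ≈W ΔT v → u ≡ v)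
    × (ΔT {k} (zero ∷ []) ≈W (inj₂ id ∷ []))
    × (∀ (u v : List⁺ (Fin (suc k))) → head u ≡ zero → head v ≡ zero → ΔT (u ⊗ v) ≈W (ΔT u ∘T ΔT v))
mainTheorem4 {k} = injective , unit , homomorphism
  where
    injective : ∀ (u v : List⁺ (Fin (suc k))) → head u ≡ zero → head v ≡ zero → ΔT u ≈W ΔT v → u ≡ v
    injective (_ ∷ us) (_ ∷ vs) refl refl p = cong (zero ∷_) (ΔT′-injective zero us vs _ _ p)

    unit : ΔT {k} (zero ∷ []) ≈W (inj₂ id ∷ [])
    unit = gap≈ ρ-zero ∷ []

    homomorphism : ∀ (u v : List⁺ (Fin (suc k))) → head u ≡ zero → head v ≡ zero → ΔT (u ⊗ v) ≈W (ΔT u ∘T ΔT v)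
    homomorphism (_ ∷ us) (b ∷ vs) refl _ = transport refl (ΔT-⊗ b vs) composition
      where
        open Homomorphism us
        composition : ΔT u ∘T ΔT (b ∷ vs) ≡ (P ^W suc (length vs)) ⟨ ΔT′ b vs ⟩
        composition = begin
          ΔT u ∘T ΔT (b ∷ vs)                        ≡⟨ cong₂ _∘T_ (ΔT-unfold zero us) (ΔT-unfold b vs) ⟩
          P ∘T ΔT′ b vs                               ≡⟨ ∘T-oneGap P (ΔT′ b vs) (gaps-ΔT′ zero us) ⟩
          (P ^W length (ΔT′ b vs)) ⟨ ΔT′ b vs ⟩     ≡⟨ cong (λ m → (P ^W m) ⟨ ΔT′ b vs ⟩) (length-ΔT′ b vs) ⟩
          (P ^W suc (length vs)) ⟨ ΔT′ b vs ⟩       ∎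
          where open ≡-Reasoning
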